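{- Let $X = \mathrm{Cay}(\mathbb{Z}_n, S)$ be a circulant graph, and let $H$ and $K$ be nontrivial subgroups of $\mathbb{Z}_n$ with $|K|$ even such that, letting $K_o = K \setminus 2K$, we have $(S \setminus K_o) + H \subseteq S \cup K_o$, and either $|H| \neq 2$ or $|K|$ is divisible by $4$. If $n$ is not divisible by $4$, then $X$ has Wilson type (C.1), i.e., there is a nonzero $h \in 2\mathbb{Z}_n$ with $h + S_e = S_e$, where $S_e = S \cap 2\mathbb{Z}_n$.
   Context: All graphs are finite, simple and undirected. For an abelian group $G$ and $S \subseteq G$ with $-S = S$, $0 \notin S$, $\mathrm{Cay}(G,S)$ has vertex set $G$ with $v \sim w$ iff $w - v \in S$. For a subgroup $K$, $2K = \{2k : k \in K\}$; $A + H = \{a+h : a \in A, h \in H\}$. (Since $|K|$ is even, $n$ is even.) -}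

module Defs where

open import Data.Nat using (ℕ; NonZero; _+_; _∸_; _%_)
open import Data.Nat.DivMod using (m%n<n)
open import Data.Fin using (Fin; toℕ; fromℕ<)
open import Data.Fin.Subset using (Subset; _∈_; _∉_; ∣_∣)
open import Data.Product using (Σ; _×_; ∃; ∃-syntax)
open import Data.Sum using (_⊎_)
open import Relation.Binary.PropositionalEquality using (_≡_; _≢_)
open import Relation.Nullary using (¬_)

module ZMod (n : ℕ) .{{_ : NonZero n}} where

  Zn : Set
  Zn = Fin n

  0ₙ : Zn
  0ₙ = fromℕ< (m%n<n 0 n)

  infixl 6 _⊕_
  _⊕_ : Zn → Zn → Zn
  a ⊕ b = fromℕ< (m%n<n (toℕ a + toℕ b) n)

  ⊖_ : Zn → Zn
  ⊖ a = fromℕ< (m%n<n (n ∸ toℕ a) n)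

  -- -S = S (closure under negation; equivalent to equality for finite sets)
  SymmetricSet : Subset n → Set
  SymmetricSet S = ∀ s → s ∈ S → ⊖ s ∈ S

  IsConnectionSet : Subset n → Set
  IsConnectionSet S = SymmetricSet S × 0ₙ ∉ S

  IsSubgroup : Subset n → Set
  IsSubgroup K = 0ₙ ∈ K
               × (∀ a b → a ∈ K → b ∈ K → a ⊕ b ∈ K)
               × (∀ a → a ∈ K → ⊖ a ∈ K)

  Nontrivial : Subset n → Set
  Nontrivial K = ∃[ k ] (k ∈ K × k ≢ 0ₙ)

  In2 : Subset n → Zn → Set
  In2 K x = ∃[ k ] (k ∈ K × x ≡ k ⊕ k)

  InTwoZn : Zn → Set
  InTwoZn x = ∃[ a ] (x ≡ a ⊕ a)

  InKo : Subset n → Zn → Set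
  InKo K x = x ∈ K × ¬ In2 K x

  InSe : Subset n → Zn → Set
  InSe S x = x ∈ S × InTwoZn x

  WilsonTypeC1 : Subset n → Set
  WilsonTypeC1 S =
    ∃[ h ] ( InTwoZn h × h ≢ 0ₙ
           × (∀ s → InSe S s → InSe S (h ⊕ s))
           × (∀ t → InSe S t → ∃[ s ] (InSe S s × t ≡ h ⊕ s)) )

-- Since 4 ∤ n, doubling is invertible on 2ℤₙ (some multiple c · _ halves every even
-- element), so every even element of a subgroup K lies in 2K and 2ℤₙ meets no Kₒ.  Hence
-- for even h ∈ H the hypothesis (S ∖ Kₒ) + H ⊆ S ∪ Kₒ gives Sₑ + h ⊆ Sₑ, and the same for
-- −h.  A nontrivial subgroup of ℤₙ is the set of multiples of its least positive element d,
-- and |K| · d = n.  So if every element of H had order at most 2, then H = {0, n/2} and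
-- |H| = 2, while 4 ∣ |K| would force 4 ∣ n; thus some g ∈ H has 2g ≠ 0, and h = 2g works.

module Submission where

open import Defs
open import Algebra.Bundles using (AbelianGroup)
open import Data.Bool.Base using (if_then_else_)
open import Data.Nat.Base using (ℕ; zero; suc; _+_; _*_; _∸_; _<_; _≤_; z≤n; s≤s; NonZero; >-nonZero)
open import Data.Nat.Properties
  using ( +-identityʳ; +-suc; +-assoc; +-comm; *-comm; *-cancelʳ-≡; m∸n+n≡m; m≤m+n; +-monoʳ-≤; +-mono-<
        ; ≤-refl; ≤-trans; ≤-pred; <-trans; <-≤-trans; <-irrefl; <⇒≤; <⇒≱; ≮⇒≥; n≤0⇒n≡0; _<?_ )
open import Data.Nat.DivMod
  using (_%_; _/_; m%n<n; m≡m%n+[m/n]*n; %-distribˡ-+; m%n%n≡m%n; m*n%n≡0; m<n⇒m%n≡m; [m+n]%n≡m%n)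
open import Data.Nat.Divisibility using (_∣_; _∣?_; divides; ∣m+n∣m⇒∣n; ∣⇒≤; ∣-trans; m%n≡0⇒n∣m)
open import Data.Nat.Tactic.RingSolver using (solve-∀)
open import Data.Fin.Base using (Fin; toℕ; fromℕ<)
open import Data.Fin.Properties using (toℕ-fromℕ<; toℕ-injective; toℕ<n; any?; _≟_)
open import Data.Fin.Subset using (Subset; _∈_; ∣_∣)
open import Data.Fin.Subset.Properties using (_∈?_; ⊆-antisym)
open import Data.Product.Base using (∃-syntax; ∃₂; _×_; _,_; proj₁; proj₂)
open import Data.Sum.Base using (_⊎_; fromInj₁)
open import Data.Vec.Base using (tabulate)
open import Data.Vec.Properties using (tabulate-cong; lookup∘tabulate; []=⇒lookup; lookup⇒[]=)
open import Function.Base using (_∘_)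
open import Level using (0ℓ)
open import Relation.Nullary.Decidable using (yes; no; does; dec-true; _×-dec_)
open import Relation.Nullary.Negation using (¬_; contradiction)
open import Relation.Unary using (Pred; Decidable)
open import Relation.Binary.PropositionalEquality

module _ (d : ℕ) where

  multiplesOf : (n : ℕ) → Subset n
  multiplesOf n = tabulate (λ i → does (d ∣? toℕ i))

  ∈multiplesOf⁺ : ∀ {n} {x : Fin n} → d ∣ toℕ x → x ∈ multiplesOf n
  ∈multiplesOf⁺ {x = x} d∣x =
    lookup⇒[]= x _ (trans (lookup∘tabulate _ x) (dec-true (d ∣? toℕ x) d∣x))

  ∈multiplesOf⁻ : ∀ {n} {x : Fin n} → x ∈ multiplesOf n → d ∣ toℕ x
  ∈multiplesOf⁻ {x = x} x∈ with d ∣? toℕ x | trans (sym (lookup∘tabulate _ x)) ([]=⇒lookup x∈)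
  ... | yes d∣x | _ = d∣x

  multiplesIn : (a N : ℕ) → ℕ
  multiplesIn a zero    = 0
  multiplesIn a (suc N) = (if does (d ∣? a) then 1 else 0) + multiplesIn (suc a) N

  ∣tabulate∣≡multiplesIn : ∀ a N → ∣ tabulate {n = N} (λ i → does (d ∣? (a + toℕ i))) ∣ ≡ multiplesIn a N
  ∣tabulate∣≡multiplesIn a zero = refl
  ∣tabulate∣≡multiplesIn a (suc N)
    rewrite +-identityʳ a
          | tabulate-cong {n = N} (λ i → cong (does ∘ (d ∣?_)) (+-suc a (toℕ i)))
    with d ∣? a
  ... | yes _ = cong suc (∣tabulate∣≡multiplesIn (suc a) N)
  ... | no _  = ∣tabulate∣≡multiplesIn (suc a) N

  multiplesIn-+ : ∀ a N M → multiplesIn a (N + M) ≡ multiplesIn a N + multiplesIn (N + a) M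
  multiplesIn-+ a zero    M = refl
  multiplesIn-+ a (suc N) M = begin
    i + multiplesIn (suc a) (N + M)
      ≡⟨ cong (i +_) (multiplesIn-+ (suc a) N M) ⟩
    i + (multiplesIn (suc a) N + multiplesIn (N + suc a) M)
      ≡⟨ +-assoc i _ _ ⟨
    multiplesIn a (suc N) + multiplesIn (N + suc a) M
      ≡⟨ cong (λ b → multiplesIn a (suc N) + multiplesIn b M) (+-suc N a) ⟩
    multiplesIn a (suc N) + multiplesIn (suc N + a) M
      ∎
    where
    open ≡-Reasoning
    i = if does (d ∣? a) then 1 else 0

  multiplesIn-none : ∀ a N → (∀ j → j < N → ¬ d ∣ a + j) → multiplesIn a N ≡ 0
  multiplesIn-none a zero    _    = refl
  multiplesIn-none a (suc N) none with d ∣? a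
  ... | yes d∣a = contradiction (subst (d ∣_) (sym (+-identityʳ a)) d∣a) (none 0 (s≤s z≤n))
  ... | no _    = multiplesIn-none (suc a) N
                    (λ j j<N → subst (λ b → ¬ d ∣ b) (+-suc a j) (none (suc j) (s≤s j<N)))

module _ (e : ℕ) where
  private d = suc e

  multiplesIn-block : ∀ k → multiplesIn d (k * d) d ≡ 1
  multiplesIn-block k rewrite dec-true (d ∣? k * d) (divides k refl) =
    cong suc (multiplesIn-none d (suc (k * d)) e no-multiple)
    where
    no-multiple : ∀ j → j < e → ¬ d ∣ suc (k * d) + j
    no-multiple j j<e d∣ = <⇒≱ (s≤s j<e) (∣⇒≤ (∣m+n∣m⇒∣n
      (subst (d ∣_) (sym (+-suc (k * d) j)) d∣) (divides k refl)))

  multiplesIn-* : ∀ j k → multiplesIn d (j * d) (k * d) ≡ k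
  multiplesIn-* j zero    = refl
  multiplesIn-* j (suc k) = begin
    multiplesIn d (j * d) (d + k * d)
      ≡⟨ multiplesIn-+ d (j * d) d (k * d) ⟩
    multiplesIn d (j * d) d + multiplesIn d (suc j * d) (k * d)
      ≡⟨ cong₂ _+_ (multiplesIn-block j) (multiplesIn-* (suc j) k) ⟩
    suc k
      ∎
    where open ≡-Reasoning

∣multiplesOf∣*d≡n : ∀ {d n} → 0 < d → d ∣ n → ∣ multiplesOf d n ∣ * d ≡ n
∣multiplesOf∣*d≡n {suc e} {n} _ (divides q refl) =
  cong (_* suc e) (trans (∣tabulate∣≡multiplesIn (suc e) 0 (q * suc e)) (multiplesIn-* e 0 q))

module _ {n p} {P : Pred (Fin n) p} (P? : Decidable P) where

  least : ∀ {x} → P x → ∃[ y ] (P y × ∀ {z} → P z → toℕ y ≤ toℕ z)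
  least {x} px = descend (suc (toℕ x)) px ≤-refl
    where
    descend : ∀ b {x} → P x → toℕ x < b → ∃[ y ] (P y × ∀ {z} → P z → toℕ y ≤ toℕ z)
    descend (suc b) {x} px x<b with any? (λ z → P? z ×-dec toℕ z <? toℕ x)
    ... | yes (z , pz , z<x) = descend b pz (<-≤-trans z<x (≤-pred x<b))
    ... | no ∄smaller        = x , px , λ pz → ≮⇒≥ (λ z<x → ∄smaller (_ , pz , z<x))

-- For x = 2a we get (c + c) · x = x + r · 2a = x, since m ∣ 2r: c halves the even elements.
¬4∣⇒halving : ∀ m → ¬ 4 ∣ m → ∃₂ λ c r → c + c ≡ suc r × m ∣ r + r
¬4∣⇒halving m 4∤m =
  subst Halving (sym m≡) (by-residue (m % 4) (m / 4) (m%n<n m 4) (subst (λ k → ¬ 4 ∣ k) m≡ 4∤m))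
  where
  Halving : ℕ → Set
  Halving k = ∃₂ λ c r → c + c ≡ suc r × k ∣ r + r
  m≡ : m ≡ m % 4 + m / 4 * 4
  m≡ = m≡m%n+[m/n]*n m 4
  by-residue : ∀ j q → j < 4 → ¬ 4 ∣ j + q * 4 → Halving (j + q * 4)
  by-residue 0 q _ 4∤ = contradiction (divides q refl) 4∤
  by-residue 1 q _ _ = 2 * q + 1 , 1 + q * 4 , eq₁ q , divides 2 (eq₂ q)
    where
    eq₁ : ∀ q → (2 * q + 1) + (2 * q + 1) ≡ 2 + q * 4
    eq₁ = solve-∀
    eq₂ : ∀ q → (1 + q * 4) + (1 + q * 4) ≡ 2 * (1 + q * 4)
    eq₂ = solve-∀
  by-residue 2 q _ _ = q + 1 , 2 * q + 1 , eq₁ q , divides 1 (eq₂ q)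
    where
    eq₁ : ∀ q → (q + 1) + (q + 1) ≡ 1 + (2 * q + 1)
    eq₁ = solve-∀
    eq₂ : ∀ q → (2 * q + 1) + (2 * q + 1) ≡ 1 * (2 + q * 4)
    eq₂ = solve-∀
  by-residue 3 q _ _ = 2 * q + 2 , 3 + q * 4 , eq₁ q , divides 2 (eq₂ q)
    where
    eq₁ : ∀ q → (2 * q + 2) + (2 * q + 2) ≡ 4 + q * 4
    eq₁ = solve-∀
    eq₂ : ∀ q → (3 + q * 4) + (3 + q * 4) ≡ 2 * (3 + q * 4)
    eq₂ = solve-∀
  by-residue (suc (suc (suc (suc _)))) _ (s≤s (s≤s (s≤s (s≤s ())))) _

module ZModProperties (n : ℕ) .{{_ : NonZero n}} where
  open ZMod n

  infix 4 _≈_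
  _≈_ : ℕ → ℕ → Set
  a ≈ b = a % n ≡ b % n

  +-cong-≈ : ∀ {a a′ b b′} → a ≈ a′ → b ≈ b′ → a + b ≈ a′ + b′
  +-cong-≈ {a} {a′} {b} {b′} a≈a′ b≈b′ = begin
    (a + b) % n               ≡⟨ %-distribˡ-+ a b n ⟩
    (a % n + b % n) % n       ≡⟨ cong₂ (λ x y → (x + y) % n) a≈a′ b≈b′ ⟩
    (a′ % n + b′ % n) % n     ≡⟨ %-distribˡ-+ a′ b′ n ⟨
    (a′ + b′) % n             ∎
    where open ≡-Reasoning

  %-≈ : ∀ a → a % n ≈ a
  %-≈ a = m%n%n≡m%n a n

  toℕ-0ₙ : toℕ 0ₙ ≡ 0
  toℕ-0ₙ = trans (toℕ-fromℕ< _) (m*n%n≡0 0 n)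

  toℕ-⊕ : ∀ a b → toℕ (a ⊕ b) ≈ toℕ a + toℕ b
  toℕ-⊕ a b = trans (cong (_% n) (toℕ-fromℕ< _)) (%-≈ (toℕ a + toℕ b))

  toℕ-⊖ : ∀ a → toℕ (⊖ a) + toℕ a ≈ 0
  toℕ-⊖ a = begin
    (toℕ (⊖ a) + toℕ a) % n        ≡⟨ +-cong-≈ (trans (cong (_% n) (toℕ-fromℕ< _)) (%-≈ (n ∸ toℕ a))) refl ⟩
    (n ∸ toℕ a + toℕ a) % n        ≡⟨ cong (_% n) (m∸n+n≡m (<⇒≤ (toℕ<n a))) ⟩
    n % n                          ≡⟨ [m+n]%n≡m%n 0 n ⟩
    0 % n                          ∎
    where open ≡-Reasoning

  ≈⇒≡ : ∀ {a b} → toℕ a ≈ toℕ b → a ≡ b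
  ≈⇒≡ {a} {b} a≈b = toℕ-injective (begin
    toℕ a      ≡⟨ m<n⇒m%n≡m (toℕ<n a) ⟨
    toℕ a % n  ≡⟨ a≈b ⟩
    toℕ b % n  ≡⟨ m<n⇒m%n≡m (toℕ<n b) ⟩
    toℕ b      ∎)
    where open ≡-Reasoning

  ⊕-comm : ∀ a b → a ⊕ b ≡ b ⊕ a
  ⊕-comm a b = ≈⇒≡ (begin
    toℕ (a ⊕ b) % n        ≡⟨ toℕ-⊕ a b ⟩
    (toℕ a + toℕ b) % n    ≡⟨ cong (_% n) (+-comm (toℕ a) (toℕ b)) ⟩
    (toℕ b + toℕ a) % n    ≡⟨ toℕ-⊕ b a ⟨
    toℕ (b ⊕ a) % n        ∎)
    where open ≡-Reasoning

  ⊕-assoc : ∀ a b c → (a ⊕ b) ⊕ c ≡ a ⊕ (b ⊕ c)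
  ⊕-assoc a b c = ≈⇒≡ (begin
    toℕ ((a ⊕ b) ⊕ c) % n            ≡⟨ trans (toℕ-⊕ (a ⊕ b) c) (+-cong-≈ (toℕ-⊕ a b) refl) ⟩
    (toℕ a + toℕ b + toℕ c) % n      ≡⟨ cong (_% n) (+-assoc (toℕ a) (toℕ b) (toℕ c)) ⟩
    (toℕ a + (toℕ b + toℕ c)) % n    ≡⟨ trans (toℕ-⊕ a (b ⊕ c)) (+-cong-≈ {toℕ a} refl (toℕ-⊕ b c)) ⟨
    toℕ (a ⊕ (b ⊕ c)) % n            ∎)
    where open ≡-Reasoning

  ⊕-identityˡ : ∀ a → 0ₙ ⊕ a ≡ a
  ⊕-identityˡ a = ≈⇒≡ (trans (toℕ-⊕ 0ₙ a) (cong (λ z → (z + toℕ a) % n) toℕ-0ₙ))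

  ⊖-inverseˡ : ∀ a → ⊖ a ⊕ a ≡ 0ₙ
  ⊖-inverseˡ a = ≈⇒≡ (trans (trans (toℕ-⊕ (⊖ a) a) (toℕ-⊖ a)) (cong (_% n) (sym toℕ-0ₙ)))

  ℤₙ-abelianGroup : AbelianGroup 0ℓ 0ℓ
  ℤₙ-abelianGroup = record
    { Carrier = Zn
    ; _≈_ = _≡_
    ; _∙_ = _⊕_
    ; ε = 0ₙ
    ; _⁻¹ = ⊖_
    ; isAbelianGroup = record
      { isGroup = record
        { isMonoid = record
          { isSemigroup = record
            { isMagma = record { isEquivalence = isEquivalence ; ∙-cong = cong₂ _⊕_ }
            ; assoc = ⊕-assoc
            }
          ; identity = ⊕-identityˡ , λ a → trans (⊕-comm a 0ₙ) (⊕-identityˡ a)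
          }
        ; inverse = ⊖-inverseˡ , λ a → trans (⊕-comm a (⊖ a)) (⊖-inverseˡ a)
        ; ⁻¹-cong = cong ⊖_
        }
      ; comm = ⊕-comm
      }
    }

  open AbelianGroup ℤₙ-abelianGroup using (rawMonoid; monoid; commutativeMonoid; commutativeSemigroup)
  open import Algebra.Definitions.RawMonoid rawMonoid using () renaming (_×_ to infixr 8 _·_)
  open import Algebra.Properties.Monoid.Mult monoid using (×-homo-+; ×-assocˡ)
  open import Algebra.Properties.CommutativeMonoid.Mult commutativeMonoid using (×-distrib-+)
  open import Algebra.Properties.CommutativeSemigroup commutativeSemigroup using (interchange)
  open import Algebra.Properties.AbelianGroup ℤₙ-abelianGroup using (⁻¹-∙-comm; x≈z//y; \\-leftDividesˡ)

  toℕ-· : ∀ m x → toℕ (m · x) ≈ m * toℕ x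
  toℕ-· zero    x = cong (_% n) toℕ-0ₙ
  toℕ-· (suc m) x = trans (toℕ-⊕ x (m · x)) (+-cong-≈ {toℕ x} refl (toℕ-· m x))

  n·x≡0ₙ : ∀ x → n · x ≡ 0ₙ
  n·x≡0ₙ x = ≈⇒≡ (begin
    toℕ (n · x) % n   ≡⟨ toℕ-· n x ⟩
    (n * toℕ x) % n   ≡⟨ cong (_% n) (*-comm n (toℕ x)) ⟩
    (toℕ x * n) % n   ≡⟨ trans (m*n%n≡0 (toℕ x) n) (sym (m*n%n≡0 0 n)) ⟩
    0 % n             ≡⟨ cong (_% n) toℕ-0ₙ ⟨
    toℕ 0ₙ % n        ∎)
    where open ≡-Reasoning

  toℕ-0ₙ≈n : toℕ 0ₙ ≈ n
  toℕ-0ₙ≈n = trans (cong (_% n) toℕ-0ₙ) (sym ([m+n]%n≡m%n 0 n))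

  ≢0ₙ⇒0<toℕ : ∀ {x} → x ≢ 0ₙ → 0 < toℕ x
  ≢0ₙ⇒0<toℕ {x} x≢0 with toℕ x in eq
  ... | zero  = contradiction (toℕ-injective (trans eq (sym toℕ-0ₙ))) x≢0
  ... | suc _ = s≤s z≤n

  x⊕x≡0ₙ⇒toℕx+toℕx≡n : ∀ {x} → 0 < toℕ x → x ⊕ x ≡ 0ₙ → toℕ x + toℕ x ≡ n
  x⊕x≡0ₙ⇒toℕx+toℕx≡n {x} 0<t x⊕x≡0 = multiple⇒≡n (m%n≡0⇒n∣m (t + t) n (begin
    (t + t) % n       ≡⟨ toℕ-⊕ x x ⟨
    toℕ (x ⊕ x) % n   ≡⟨ cong (λ z → toℕ z % n) x⊕x≡0 ⟩
    toℕ 0ₙ % n        ≡⟨ cong (_% n) toℕ-0ₙ ⟩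
    0 % n             ≡⟨ m*n%n≡0 0 n ⟩
    0                 ∎))
    where
    open ≡-Reasoning
    t = toℕ x
    multiple⇒≡n : n ∣ t + t → t + t ≡ n
    multiple⇒≡n (divides zero t+t≡0) =
      contradiction (subst (0 <_) t+t≡0 (≤-trans 0<t (m≤m+n t t))) (<-irrefl refl)
    multiple⇒≡n (divides (suc zero) t+t≡n+0) = trans t+t≡n+0 (+-identityʳ n)
    multiple⇒≡n (divides (suc (suc j)) t+t≡n+n+jn) = contradiction
      (subst (n + n ≤_) (sym t+t≡n+n+jn) (+-monoʳ-≤ n (m≤m+n n (j * n))))
      (<⇒≱ (+-mono-< (toℕ<n x) (toℕ<n x)))

  InTwoZn-⊕ : ∀ {a b} → InTwoZn a → InTwoZn b → InTwoZn (a ⊕ b)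
  InTwoZn-⊕ (x , refl) (y , refl) = x ⊕ y , interchange x x y y

  InTwoZn-⊖ : ∀ {a} → InTwoZn a → InTwoZn (⊖ a)
  InTwoZn-⊖ (x , refl) = ⊖ x , sym (⁻¹-∙-comm x x)

  module _ {K : Subset n} (K≤ : IsSubgroup K) where

    ·-closed : ∀ m {x} → x ∈ K → m · x ∈ K
    ·-closed zero    _   = proj₁ K≤
    ·-closed (suc m) x∈K = proj₁ (proj₂ K≤) _ _ x∈K (·-closed m x∈K)

    ∣⇒∈ : ∀ {x y} → y ∈ K → toℕ y ∣ toℕ x → x ∈ K
    ∣⇒∈ {x} {y} y∈K (divides q toℕx≡q*toℕy) =
      subst (_∈ K) (≈⇒≡ (trans (toℕ-· q y) (cong (_% n) (sym toℕx≡q*toℕy)))) (·-closed q y∈K)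

    least-positive-∣ : ∀ {y} → y ∈ K → 0 < toℕ y → (∀ {z} → z ∈ K × 0 < toℕ z → toℕ y ≤ toℕ z) →
                       ∀ {x m} → x ∈ K → toℕ x ≈ m → toℕ y ∣ m
    least-positive-∣ {y} y∈K 0<d minimal {x} {m} x∈K x≈m =
      m%n≡0⇒n∣m m d (n≤0⇒n≡0 (≮⇒≥ λ 0<r →
        <⇒≱ (m%n<n m d) (subst (d ≤_) toℕw≡r (minimal (w∈K , subst (0 <_) (sym toℕw≡r) 0<r)))))
      where
      d = toℕ y
      instance _ = >-nonZero 0<d
      q = m / d
      r<n : m % d < n
      r<n = <-trans (m%n<n m d) (toℕ<n y)
      w = fromℕ< r<n
      toℕw≡r : toℕ w ≡ m % d
      toℕw≡r = toℕ-fromℕ< r<n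
      w⊕qy≡x : w ⊕ q · y ≡ x
      w⊕qy≡x = ≈⇒≡ (begin
        toℕ (w ⊕ q · y) % n         ≡⟨ toℕ-⊕ w (q · y) ⟩
        (toℕ w + toℕ (q · y)) % n   ≡⟨ +-cong-≈ (cong (_% n) toℕw≡r) (toℕ-· q y) ⟩
        (m % d + q * d) % n         ≡⟨ cong (_% n) (m≡m%n+[m/n]*n m d) ⟨
        m % n                       ≡⟨ x≈m ⟨
        toℕ x % n                   ∎)
        where open ≡-Reasoning
      w∈K : w ∈ K
      w∈K = subst (_∈ K) (sym (x≈z//y w (q · y) x w⊕qy≡x))
              (proj₁ (proj₂ K≤) _ _ x∈K (proj₂ (proj₂ K≤) _ (·-closed q y∈K)))

    ∣K∣*least≡n : Nontrivial K → ∃[ y ] (y ∈ K × 0 < toℕ y × ∣ K ∣ * toℕ y ≡ n)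
    ∣K∣*least≡n (k , k∈K , k≢0)
      with least (λ z → z ∈? K ×-dec 0 <? toℕ z) (k∈K , ≢0ₙ⇒0<toℕ k≢0)
    ... | y , (y∈K , 0<d) , minimal = y , y∈K , 0<d , (begin
      ∣ K ∣ * toℕ y                  ≡⟨ cong (λ P → ∣ P ∣ * toℕ y) K≡multiples ⟩
      ∣ multiplesOf (toℕ y) n ∣ * toℕ y ≡⟨ ∣multiplesOf∣*d≡n 0<d (divides′ (proj₁ K≤) toℕ-0ₙ≈n) ⟩
      n                               ∎)
      where
      open ≡-Reasoning
      divides′ : ∀ {x m} → x ∈ K → toℕ x ≈ m → toℕ y ∣ m
      divides′ = least-positive-∣ y∈K 0<d minimal
      K≡multiples : K ≡ multiplesOf (toℕ y) n
      K≡multiples = ⊆-antisym (λ x∈K → ∈multiplesOf⁺ (toℕ y) (divides′ x∈K refl))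
                              (λ x∈ → ∣⇒∈ y∈K (∈multiplesOf⁻ (toℕ y) x∈))

    ∣K∣∣n : Nontrivial K → ∣ K ∣ ∣ n
    ∣K∣∣n K≢0 with ∣K∣*least≡n K≢0
    ... | y , _ , _ , eq = divides (toℕ y) (trans (sym eq) (*-comm ∣ K ∣ (toℕ y)))

    ∣K∣≢2⇒∃x⊕x≢0ₙ : Nontrivial K → ∣ K ∣ ≢ 2 → ∃[ x ] (x ∈ K × x ⊕ x ≢ 0ₙ)
    ∣K∣≢2⇒∃x⊕x≢0ₙ K≢0 ∣K∣≢2 with ∣K∣*least≡n K≢0
    ... | y , y∈K , 0<d , ∣K∣*d≡n with y ⊕ y ≟ 0ₙ
    ...   | no  y⊕y≢0 = y , y∈K , y⊕y≢0
    ...   | yes y⊕y≡0 = contradiction (*-cancelʳ-≡ ∣ K ∣ 2 (toℕ y) {{>-nonZero 0<d}} (begin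
      ∣ K ∣ * toℕ y          ≡⟨ ∣K∣*d≡n ⟩
      n                      ≡⟨ x⊕x≡0ₙ⇒toℕx+toℕx≡n 0<d y⊕y≡0 ⟨
      toℕ y + toℕ y          ≡⟨ cong (toℕ y +_) (+-identityʳ (toℕ y)) ⟨
      2 * toℕ y              ∎)) ∣K∣≢2
      where open ≡-Reasoning

    InTwoZn⇒In2 : ¬ 4 ∣ n → ∀ {x} → x ∈ K → InTwoZn x → In2 K x
    InTwoZn⇒In2 4∤n {x} x∈K (a , x≡a⊕a) with ¬4∣⇒halving n 4∤n
    ... | c , r , c+c≡1+r , divides j r+r≡jn = c · x , ·-closed c x∈K , sym (begin
      c · x ⊕ c · x           ≡⟨ ×-homo-+ x c c ⟨
      (c + c) · x             ≡⟨ cong (_· x) c+c≡1+r ⟩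
      x ⊕ r · x               ≡⟨ cong (λ z → x ⊕ r · z) x≡a⊕a ⟩
      x ⊕ r · (a ⊕ a)         ≡⟨ cong (x ⊕_) (×-distrib-+ a a r) ⟩
      x ⊕ (r · a ⊕ r · a)     ≡⟨ cong (x ⊕_) (×-homo-+ a r r) ⟨
      x ⊕ (r + r) · a         ≡⟨ cong (λ k → x ⊕ k · a) (trans r+r≡jn (*-comm j n)) ⟩
      x ⊕ (n * j) · a         ≡⟨ cong (x ⊕_) (×-assocˡ a n j) ⟨
      x ⊕ n · (j · a)         ≡⟨ cong (x ⊕_) (n·x≡0ₙ (j · a)) ⟩
      x ⊕ 0ₙ                  ≡⟨ trans (⊕-comm x 0ₙ) (⊕-identityˡ x) ⟩
      x                       ∎)
      where open ≡-Reasoning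

    InTwoZn⇒¬InKo : ¬ 4 ∣ n → ∀ {x} → InTwoZn x → ¬ InKo K x
    InTwoZn⇒¬InKo 4∤n x∈2ℤₙ (x∈K , x∉2K) = x∉2K (InTwoZn⇒In2 4∤n x∈K x∈2ℤₙ)

  even-translation-preserves-Se : ∀ {S H K} → IsSubgroup K → ¬ 4 ∣ n →
    (∀ s h → s ∈ S → ¬ InKo K s → h ∈ H → (s ⊕ h) ∈ S ⊎ InKo K (s ⊕ h)) →
    ∀ {h s} → h ∈ H → InTwoZn h → InSe S s → InSe S (h ⊕ s)
  even-translation-preserves-Se {S} {H} {K} K≤ 4∤n S∖Kₒ+H⊆S∪Kₒ {h} {s} h∈H h∈2ℤₙ (s∈S , s∈2ℤₙ) =
    subst (InSe S) (⊕-comm s h) (s⊕h∈S , s⊕h∈2ℤₙ)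
    where
    s⊕h∈2ℤₙ : InTwoZn (s ⊕ h)
    s⊕h∈2ℤₙ = InTwoZn-⊕ s∈2ℤₙ h∈2ℤₙ
    s⊕h∈S : s ⊕ h ∈ S
    s⊕h∈S = fromInj₁ (λ s⊕h∈Kₒ → contradiction s⊕h∈Kₒ (InTwoZn⇒¬InKo K≤ 4∤n s⊕h∈2ℤₙ))
              (S∖Kₒ+H⊆S∪Kₒ s h s∈S (InTwoZn⇒¬InKo K≤ 4∤n s∈2ℤₙ) h∈H)

  translation-invariant⇒WilsonTypeC1 : ∀ {S h} → InTwoZn h → h ≢ 0ₙ →
    (∀ {s} → InSe S s → InSe S (h ⊕ s)) → (∀ {s} → InSe S s → InSe S (⊖ h ⊕ s)) → WilsonTypeC1 S
  translation-invariant⇒WilsonTypeC1 {h = h} h∈2ℤₙ h≢0 +h -h =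
    h , h∈2ℤₙ , h≢0 , (λ _ → +h) , λ t t∈Se → ⊖ h ⊕ t , -h t∈Se , sym (\\-leftDividesˡ h t)

proposition3p5 : (n : ℕ) .{{_ : NonZero n}} → (S H K : Subset n) →
    let open ZMod n in
    IsConnectionSet S →
    IsSubgroup H → Nontrivial H →
    IsSubgroup K → Nontrivial K →
    2 ∣ ∣ K ∣ →
    (∀ s h → s ∈ S → ¬ InKo K s → h ∈ H → (s ⊕ h) ∈ S ⊎ InKo K (s ⊕ h)) →
    (∣ H ∣ ≢ 2 ⊎ 4 ∣ ∣ K ∣) →
    ¬ (4 ∣ n) →
    WilsonTypeC1 S
proposition3p5 n S H K _ H≤@(_ , ⊕-closed , ⊖-closed) H≢0 K≤ K≢0 _ S∖Kₒ+H⊆S∪Kₒ ∣H∣≢2⊎4∣∣K∣ 4∤n =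
  let open ZMod n
      open ZModProperties n
      ∣H∣≢2 : ∣ H ∣ ≢ 2
      ∣H∣≢2 = fromInj₁ (λ 4∣∣K∣ _ → 4∤n (∣-trans 4∣∣K∣ (∣K∣∣n K≤ K≢0))) ∣H∣≢2⊎4∣∣K∣
      (g , g∈H , g⊕g≢0) = ∣K∣≢2⇒∃x⊕x≢0ₙ H≤ H≢0 ∣H∣≢2
      2g∈H = ⊕-closed g g g∈H g∈H
      translate = even-translation-preserves-Se K≤ 4∤n S∖Kₒ+H⊆S∪Kₒ
  in translation-invariant⇒WilsonTypeC1 (g , refl) g⊕g≢0
       (translate 2g∈H (g , refl)) (translate (⊖-closed _ 2g∈H) (InTwoZn-⊖ (g , refl)))
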